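{- Let $d,n_0\in\mathbb{N}$ and let $\epsilon>0$ be real. Then there exists a twin-free graph $G$ of minimum degree at least $d$ and order $n\geq n_0$ such that $\overset{\rightarrow}{\gamma}_{LD}(G)\geq(\tfrac12-\epsilon)n$.
   Context: Distinct vertices $u,v$ are twins if $N(u)=N(v)$ or $N[u]=N[v]$; a graph is twin-free if it has no twins. For an orientation $D$ of a graph $G=(V,E)$ (each edge given exactly one direction), $S\subseteq V$ is locating-dominating in $D$ if every $u\notin S$ has an in-neighbour in $S$ and distinct $u,v\notin S$ have distinct sets of in-neighbours in $S$; $\gamma_{LD}(D)$ is the minimum size. $\overset{\rightarrow}{\gamma}_{LD}(G)=\min_D\gamma_{LD}(D)$ over all orientations $D$ of $G$.
   Formalization: The parameter ε ranges over the positive rationals rather than over all positive reals. -}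

module Defs where

open import Data.Nat using (ℕ; _≤_)
open import Data.Bool using (Bool; true; false; if_then_else_; _∨_)
open import Data.Fin using (Fin)
open import Data.Fin.Properties using (_≟_)
open import Data.Fin.Subset using (Subset; _∈_; _∉_; ∣_∣)
open import Data.List using (map; allFin)
open import Data.Nat.ListAction using (sum)
open import Data.Product using (Σ; _×_)
open import Data.Sum using (_⊎_)
open import Relation.Nullary using (¬_; does)
open import Relation.Binary.PropositionalEquality using (_≡_)
import Data.Integer as ℤ
open import Data.Rational using (ℚ; _/_)

record Graph (n : ℕ) : Set where
  field
    adj    : Fin n → Fin n → Bool
    sym    : ∀ u v → adj u v ≡ adj v u
    irrefl : ∀ v → adj v v ≡ false
open Graph public

module _ {n : ℕ} (G : Graph n) where

  degree : Fin n → ℕ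
  degree v = sum (map (λ w → if adj G v w then 1 else 0) (allFin n))

  minDegreeAtLeast : ℕ → Set
  minDegreeAtLeast d = ∀ v → d ≤ degree v

  closedAdj : Fin n → Fin n → Bool
  closedAdj u w = does (u ≟ w) ∨ adj G u w

  Twins : Fin n → Fin n → Set
  Twins u v = (∀ w → adj G u w ≡ adj G v w) ⊎ (∀ w → closedAdj u w ≡ closedAdj v w)

  TwinFree : Set
  TwinFree = ∀ u v → ¬ (u ≡ v) → ¬ Twins u v

  record Orientation : Set where
    field
      arc       : Fin n → Fin n → Bool
      arc⇒adj   : ∀ u v → arc u v ≡ true → adj G u v ≡ true
      adj⇒arc   : ∀ u v → adj G u v ≡ true → arc u v ≡ true ⊎ arc v u ≡ true
      antisym   : ∀ u v → arc u v ≡ true → arc v u ≡ false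
  open Orientation public

  LocDom : Orientation → Subset n → Set
  LocDom D S =
      (∀ u → u ∉ S → Σ (Fin n) λ w → w ∈ S × arc D w u ≡ true)
    × (∀ u v → u ∉ S → v ∉ S → ¬ (u ≡ v) →
         ¬ (∀ w → w ∈ S → arc D w u ≡ arc D w v))

  orientedLDAtLeast : ℚ → Set
  orientedLDAtLeast k = ∀ (D : Orientation) (S : Subset n) → LocDom D S →
                        Data.Rational._≤_ k (ℤ.+ ∣ S ∣ / 1)

{-# OPTIONS --safe #-}

-- Take m pairs x i – y i and a set A = {a j} of k = d + 1 further vertices; join every x i to all
-- of A and every y i to all of A except one vertex a (missed i), where each a j is missed by some
-- y i.  Given an orientation and a
-- locating-dominating set S, call a pair covered if it meets S.  If x i and y i are both outside
-- S, the in-neighbours of x i in S lie in A, so distinct uncovered pairs differ in the arcs from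
-- A into their x's and there are at most 2^k of them.  Hence |S| ≥ m − 2^k = (n − k)/2 − 2^k, which exceeds
-- (1/2 − ε) n once m is large.

module Submission where

open import Data.Bool using (Bool; true; false; not; _∧_; _∨_; if_then_else_)
open import Data.Bool.Properties using (not-¬; ¬-not; not-injective)
open import Data.Empty using (⊥-elim)
open import Data.Fin using (Fin; zero; suc; punchIn; splitAt; _↑ˡ_; _↑ʳ_)
open import Data.Fin.Properties using (_≟_; suc-injective; punchInᵢ≢i; splitAt-↑ˡ)
open import Data.Fin.Subset using (Subset; _∈_; _∉_; ∣_∣)
open import Data.Integer as ℤ using (ℤ; +_; +[1+_]; -[1+_])
import Data.Integer.Properties as ℤP
open import Data.Integer.Tactic.RingSolver using (solve-∀)
open import Data.List using (tabulate)
open import Data.List.Properties using (map-tabulate)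
open import Data.Nat as ℕ using (ℕ; zero; suc; _+_; _^_; _∸_; _≤_; z≤n; s≤s)
import Data.Nat.ListAction as List
open import Data.Nat.Coprimality using (Coprime)
open import Data.Nat.Properties hiding (_≟_; suc-injective)
open import Algebra.Properties.CommutativeMonoid.Sum +-0-commutativeMonoid
  using (sum; sum-syntax; sum-cong-≗; ∑-distrib-+; sum-remove)
open import Data.Product using (Σ; _×_; _,_; proj₁; proj₂; map₂)
open import Data.Rational using (ℚ; mkℚ; _/_; ½; _-_; _*_; 0ℚ; _<_; *<*; toℚᵘ)
import Data.Rational as ℚ
import Data.Rational.Properties as ℚP
import Data.Rational.Unnormalised as ℚᵘ
import Data.Rational.Unnormalised.Properties as ℚᵘP
open import Data.Sum using (inj₁; inj₂; [_,_]′)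
open import Data.Vec using ([]; _∷_; lookup)
open import Data.Vec.Properties using ([]=⇒lookup)
open import Function using (id; _∘_)
open import Relation.Binary.PropositionalEquality
open import Relation.Nullary using (¬_; does; yes; no; contradiction)
open import Relation.Nullary.Decidable using (dec-true; dec-false)
open import Defs hiding (sym)

_==_ : ∀ {n} → Fin n → Fin n → Bool
i == j = does (i ≟ j)

==-refl : ∀ {n} (i : Fin n) → (i == i) ≡ true
==-refl i = dec-true (i ≟ i) refl

==-≢ : ∀ {n} {i j : Fin n} → i ≢ j → (i == j) ≡ false
==-≢ {i = i} {j} = dec-false (i ≟ j)

true-false-≢ : ∀ {a b : Bool} → a ≡ true → b ≡ false → a ≢ b
true-false-≢ a≡true b≡false a≡b = not-¬ a≡true (trans a≡b b≡false)

∧-≡-true : ∀ {a b} → a ∧ b ≡ true → a ≡ true × b ≡ true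
∧-≡-true {true} {true} refl = refl , refl

∨-≡-false : ∀ {a b} → a ∨ b ≡ false → a ≡ false × b ≡ false
∨-≡-false {false} {false} refl = refl , refl

-- Counting

𝟙 : Bool → ℕ
𝟙 b = if b then 1 else 0

count : ∀ {n} → (Fin n → Bool) → ℕ
count {n} p = ∑[ i < n ] 𝟙 (p i)

sum-mono-≤ : ∀ {n} {f g : Fin n → ℕ} → (∀ i → f i ≤ g i) → sum f ≤ sum g
sum-mono-≤ {zero}  _   = z≤n
sum-mono-≤ {suc n} f≤g = +-mono-≤ (f≤g zero) (sum-mono-≤ (f≤g ∘ suc))

sum-tabulate : ∀ {n} (f : Fin n → ℕ) → List.sum (tabulate f) ≡ sum f
sum-tabulate {zero}  f = refl
sum-tabulate {suc n} f = cong (_+_ (f zero)) (sum-tabulate (f ∘ suc))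

degree≡count : ∀ {n} (G : Graph n) v → degree G v ≡ count (adj G v)
degree≡count {n} G v = trans (cong List.sum (map-tabulate id f)) (sum-tabulate f)
  where
  f : Fin n → ℕ
  f w = 𝟙 (adj G v w)

∣p∣≡count : ∀ {n} (p : Subset n) → ∣ p ∣ ≡ count (lookup p)
∣p∣≡count []          = refl
∣p∣≡count (false ∷ p) = ∣p∣≡count p
∣p∣≡count (true ∷ p)  = cong suc (∣p∣≡count p)

count-true : ∀ n → count {n} (λ _ → true) ≡ n
count-true zero    = refl
count-true (suc n) = cong suc (count-true n)

count-false : ∀ {n} {p : Fin n → Bool} → (∀ i → p i ≡ false) → count p ≡ 0
count-false {zero}  _       = refl
count-false {suc n} p≡false rewrite p≡false zero = count-false (p≡false ∘ suc)

count-complement : ∀ {n} (p : Fin n → Bool) → count p + count (not ∘ p) ≡ n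
count-complement {n} p = begin
  count p + count (not ∘ p)                ≡⟨ ∑-distrib-+ (𝟙 ∘ p) (𝟙 ∘ not ∘ p) ⟨
  ∑[ i < n ] (𝟙 (p i) + 𝟙 (not (p i)))     ≡⟨ sum-cong-≗ (λ i → 𝟙-complement (p i)) ⟩
  count {n} (λ _ → true)                   ≡⟨ count-true n ⟩
  n                                        ∎
  where
  open ≡-Reasoning
  𝟙-complement : ∀ b → 𝟙 b + 𝟙 (not b) ≡ 1
  𝟙-complement false = refl
  𝟙-complement true  = refl

count-split : ∀ {n} (p c : Fin n → Bool) →
              count p ≡ count (λ i → p i ∧ not (c i)) + count (λ i → p i ∧ c i)
count-split p c = trans (sum-cong-≗ λ i → 𝟙-split (p i) (c i))
                        (∑-distrib-+ (λ i → 𝟙 (p i ∧ not (c i))) (λ i → 𝟙 (p i ∧ c i)))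
  where
  𝟙-split : ∀ b d → 𝟙 b ≡ 𝟙 (b ∧ not d) + 𝟙 (b ∧ d)
  𝟙-split false _     = refl
  𝟙-split true  false = refl
  𝟙-split true  true  = refl

count-≢ : ∀ {n} (c : Fin n) → count (λ j → not (c == j)) ≡ n ∸ 1
count-≢ {suc n} c = begin
  count (λ j → not (c == j))                                  ≡⟨ sum-remove {i = c} (λ j → 𝟙 (not (c == j))) ⟩
  𝟙 (not (c == c)) + count (λ j → not (c == punchIn c j))     ≡⟨ cong₂ _+_ (cong (𝟙 ∘ not) (==-refl c))
                                                                          (sum-cong-≗ λ j → cong (𝟙 ∘ not) (==-≢ (punchInᵢ≢i c j ∘ sym))) ⟩
  count {n} (λ _ → true)                                      ≡⟨ count-true n ⟩
  n                                                           ∎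
  where open ≡-Reasoning

count-≤1 : ∀ {n} (p : Fin n → Bool) → (∀ i j → p i ≡ true → p j ≡ true → i ≡ j) → count p ≤ 1
count-≤1 {zero}  _ _ = z≤n
count-≤1 {suc n} p unique with p zero in p₀
... | true  = s≤s (≤-reflexive (count-false λ i → ¬-not λ pᵢ → contradiction (unique (suc i) zero pᵢ p₀) λ ()))
... | false = count-≤1 (p ∘ suc) λ i j pᵢ pⱼ → suc-injective (unique (suc i) (suc j) pᵢ pⱼ)

count-≤-2^ : ∀ k {m} (p : Fin m → Bool) (σ : Fin m → Fin k → Bool) →
             (∀ i j → p i ≡ true → p j ≡ true → σ i ≗ σ j → i ≡ j) → count p ≤ 2 ^ k
count-≤-2^ zero    p σ injective = count-≤1 p λ i j pᵢ pⱼ → injective i j pᵢ pⱼ λ ()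
count-≤-2^ (suc k) p σ injective = begin
  count p                                ≡⟨ count-split p (λ i → σ i zero) ⟩
  count (part not) + count (part id)     ≤⟨ +-mono-≤ (count-≤-2^ k _ tail (part-injective not not-injective))
                                                     (count-≤-2^ k _ tail (part-injective id id)) ⟩
  2 ^ k + 2 ^ k                          ≡⟨ cong (_+_ (2 ^ k)) (+-identityʳ (2 ^ k)) ⟨
  2 ^ suc k                              ∎
  where
  open ≤-Reasoning
  part : (Bool → Bool) → Fin _ → Bool
  part f i = p i ∧ f (σ i zero)
  tail : Fin _ → Fin k → Bool
  tail i = σ i ∘ suc
  part-injective : ∀ f → (∀ {a b} → f a ≡ f b → a ≡ b) →
                   ∀ i j → part f i ≡ true → part f j ≡ true → tail i ≗ tail j → i ≡ j
  part-injective f f-injective i j fᵢ fⱼ same-tail with ∧-≡-true fᵢ | ∧-≡-true fⱼ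
  ... | pᵢ , headᵢ | pⱼ , headⱼ = injective i j pᵢ pⱼ λ where
    zero    → f-injective (trans headᵢ (sym headⱼ))
    (suc l) → same-tail l

-- Twins and orientations

¬adj⇒¬arc : ∀ {n} {G : Graph n} (D : Orientation G) {u v} → adj G u v ≡ false → arc D u v ≡ false
¬adj⇒¬arc D {u} {v} ¬uv = ¬-not λ uv → not-¬ (arc⇒adj D u v uv) ¬uv

separated⇒¬Twins : ∀ {n} (G : Graph n) {u v w} → u ≢ w → v ≢ w → adj G u w ≢ adj G v w → ¬ Twins G u v
separated⇒¬Twins G _ _ differ (inj₁ same-open) = differ (same-open _)
separated⇒¬Twins G {u} {v} {w} u≢w v≢w differ (inj₂ same-closed) =
  differ (trans (sym (closed≡open u≢w)) (trans (same-closed w) (closed≡open v≢w)))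
  where
  closed≡open : ∀ {t} → t ≢ w → closedAdj G t w ≡ adj G t w
  closed≡open {t} t≢w = cong (_∨ adj G t w) (dec-false (t ≟ w) t≢w)

data Vertex (m k : ℕ) : Set where
  x y : Fin m → Vertex m k
  a   : Fin k → Vertex m k

x-injective : ∀ {m k} {i j : Fin m} → x {k = k} i ≡ x j → i ≡ j
x-injective refl = refl

double : ℕ → ℕ
double zero    = zero
double (suc m) = suc (suc (double m))

double≡2* : ∀ m → double m ≡ 2 ℕ.* m
double≡2* zero    = refl
double≡2* (suc m) = trans (cong (λ t → suc (suc t)) (double≡2* m)) (sym (*-suc 2 m))

shift : ∀ {m k} → Vertex m k → Vertex (suc m) k
shift (x i) = x (suc i)
shift (y i) = y (suc i)
shift (a j) = a j

-- Fin (double m + k) lists the vertices in the order x 0, y 0, x 1, y 1, …, x (m-1), y (m-1), a 0, …, a (k-1).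

decode : ∀ m {k} → Fin (double m + k) → Vertex m k
decode zero    j             = a j
decode (suc m) zero          = x zero
decode (suc m) (suc zero)    = y zero
decode (suc m) (suc (suc v)) = shift (decode m v)

encode : ∀ m {k} → Vertex m k → Fin (double m + k)
encode zero    (a j)       = j
encode (suc m) (x zero)    = zero
encode (suc m) (y zero)    = suc zero
encode (suc m) (x (suc i)) = suc (suc (encode m (x i)))
encode (suc m) (y (suc i)) = suc (suc (encode m (y i)))
encode (suc m) (a j)       = suc (suc (encode m (a j)))

decode-encode : ∀ m {k} (u : Vertex m k) → decode m (encode m u) ≡ u
decode-encode zero    (a j)       = refl
decode-encode (suc m) (x zero)    = refl
decode-encode (suc m) (y zero)    = refl
decode-encode (suc m) (x (suc i)) = cong shift (decode-encode m (x i))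
decode-encode (suc m) (y (suc i)) = cong shift (decode-encode m (y i))
decode-encode (suc m) (a j)       = cong shift (decode-encode m (a j))

encode-shift : ∀ m {k} (u : Vertex m k) → encode (suc m) (shift u) ≡ suc (suc (encode m u))
encode-shift m (x i) = refl
encode-shift m (y i) = refl
encode-shift m (a j) = refl

encode-decode : ∀ m {k} (v : Fin (double m + k)) → encode m (decode m v) ≡ v
encode-decode zero    v             = refl
encode-decode (suc m) zero          = refl
encode-decode (suc m) (suc zero)    = refl
encode-decode (suc m) (suc (suc v)) = trans (encode-shift m (decode m v)) (cong (λ t → suc (suc t)) (encode-decode m v))

decode-injective : ∀ m {k} {v w : Fin (double m + k)} → decode m v ≡ decode m w → v ≡ w
decode-injective m {v = v} {w} eq = trans (sym (encode-decode m v)) (trans (cong (encode m) eq) (encode-decode m w))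

encode-injective : ∀ m {k} {u w : Vertex m k} → encode m u ≡ encode m w → u ≡ w
encode-injective m {u = u} {w} eq = trans (sym (decode-encode m u)) (trans (cong (decode m) eq) (decode-encode m w))

sum-decode : ∀ m {k} (f : Vertex m k → ℕ) →
             ∑[ v < double m + k ] f (decode m v) ≡ ∑[ i < m ] (f (x i) + f (y i)) + ∑[ j < k ] f (a j)
sum-decode zero    f = refl
sum-decode (suc m) {k} f = begin
  f (x zero) + (f (y zero) + ∑[ v < double m + k ] f (shift (decode m v)))   ≡⟨ cong (λ t → f (x zero) + (f (y zero) + t))
                                                                                     (sum-decode m (f ∘ shift)) ⟩
  f (x zero) + (f (y zero) + (pairs + ∑[ j < k ] f (a j)))                     ≡⟨ +-assoc (f (x zero)) (f (y zero)) _ ⟨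
  (f (x zero) + f (y zero)) + (pairs + ∑[ j < k ] f (a j))                     ≡⟨ +-assoc (f (x zero) + f (y zero)) pairs _ ⟨
  (f (x zero) + f (y zero)) + pairs + ∑[ j < k ] f (a j)                       ∎
  where
  open ≡-Reasoning
  pairs : ℕ
  pairs = ∑[ i < m ] (f (x (suc i)) + f (y (suc i)))

-- The section owner of missed lets the y's tell the a's apart; the fixed-point-free partner
-- supplies an x separating x i and y i from every a j.

module Construction {m k : ℕ} (missed : Fin m → Fin k) (owner : Fin k → Fin m)
                    (missed-owner : ∀ j → missed (owner j) ≡ j)
                    (partner : Fin m → Fin m) (partner-≢ : ∀ i → partner i ≢ i) where

  edge : Vertex m k → Vertex m k → Bool
  edge (x i) (y l) = i == l
  edge (y i) (x l) = l == i
  edge (x _) (a _) = true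
  edge (a _) (x _) = true
  edge (y i) (a j) = not (missed i == j)
  edge (a j) (y i) = not (missed i == j)
  edge (x _) (x _) = false
  edge (y _) (y _) = false
  edge (a _) (a _) = false

  edge-sym : ∀ u v → edge u v ≡ edge v u
  edge-sym (x _) (x _) = refl
  edge-sym (x _) (y _) = refl
  edge-sym (x _) (a _) = refl
  edge-sym (y _) (x _) = refl
  edge-sym (y _) (y _) = refl
  edge-sym (y _) (a _) = refl
  edge-sym (a _) (x _) = refl
  edge-sym (a _) (y _) = refl
  edge-sym (a _) (a _) = refl

  edge-irrefl : ∀ u → edge u u ≡ false
  edge-irrefl (x _) = refl
  edge-irrefl (y _) = refl
  edge-irrefl (a _) = refl

  n : ℕ
  n = double m + k

  G : Graph n
  G = record
    { adj    = λ v w → edge (decode m v) (decode m w)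
    ; sym    = λ v w → edge-sym (decode m v) (decode m w)
    ; irrefl = edge-irrefl ∘ decode m
    }

  adj-encodeʳ : ∀ v u → adj G v (encode m u) ≡ edge (decode m v) u
  adj-encodeʳ v u = cong (edge (decode m v)) (decode-encode m u)

  adj-encode : ∀ u w → adj G (encode m u) (encode m w) ≡ edge u w
  adj-encode u w = cong₂ edge (decode-encode m u) (decode-encode m w)

  Separates : Vertex m k → Vertex m k → Vertex m k → Set
  Separates u v w = w ≢ u × w ≢ v × edge u w ≢ edge v w

  separates-sym : ∀ {u v w} → Separates u v w → Separates v u w
  separates-sym (w≢u , w≢v , differ) = w≢v , w≢u , differ ∘ sym

  separator : ∀ u v → u ≢ v → Σ (Vertex m k) (Separates u v)
  separator (x i) (x l) u≢v = y i , (λ ()) , (λ ()) , true-false-≢ (==-refl i) (==-≢ λ l≡i → u≢v (cong x (sym l≡i)))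
  separator (x i) (y l) _   = a (missed l) , (λ ()) , (λ ()) , true-false-≢ refl (cong not (==-refl (missed l)))
  separator (x i) (a j) _   = x (partner i) , partner-≢ i ∘ x-injective , (λ ()) , λ ()
  separator (y i) (y l) u≢v = x i , (λ ()) , (λ ()) , true-false-≢ (==-refl i) (==-≢ λ i≡l → u≢v (cong y i≡l))
  separator (y i) (a j) _   = x (partner i) , (λ ()) , (λ ()) , ≢-sym (true-false-≢ refl (==-≢ (partner-≢ i)))
  separator (a j) (a l) u≢v = y (owner j) , (λ ()) , (λ ()) ,
    ≢-sym (true-false-≢ (cong not (trans (cong (_== l) (missed-owner j)) (==-≢ λ j≡l → u≢v (cong a j≡l))))
                        (cong not (trans (cong (_== j) (missed-owner j)) (==-refl j))))
  separator (y i) (x l) u≢v = map₂ separates-sym (separator (x l) (y i) (≢-sym u≢v))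
  separator (a j) (x i) u≢v = map₂ separates-sym (separator (x i) (a j) (≢-sym u≢v))
  separator (a j) (y i) u≢v = map₂ separates-sym (separator (y i) (a j) (≢-sym u≢v))

  twinFree : TwinFree G
  twinFree v v′ v≢v′ with separator (decode m v) (decode m v′) (v≢v′ ∘ decode-injective m)
  ... | u , u≢v , u≢v′ , differ =
    separated⇒¬Twins G (encoded-≢ u≢v) (encoded-≢ u≢v′)
      λ same → differ (trans (sym (adj-encodeʳ v u)) (trans same (adj-encodeʳ v′ u)))
    where
    encoded-≢ : ∀ {t} → u ≢ decode m t → t ≢ encode m u
    encoded-≢ {t} u≢t t≡u = u≢t (trans (sym (decode-encode m u)) (cong (decode m) (sym t≡u)))

  degreeᵛ : Vertex m k → ℕ
  degreeᵛ u = count λ v → edge u (decode m v)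

  degreeᵛ-split : ∀ u → degreeᵛ u ≡ ∑[ i < m ] (𝟙 (edge u (x i)) + 𝟙 (edge u (y i))) + count (edge u ∘ a)
  degreeᵛ-split u = sum-decode m (𝟙 ∘ edge u)

  k≤degree-x : ∀ i → k ≤ degreeᵛ (x i)
  k≤degree-x i = begin
    k                         ≡⟨ count-true k ⟨
    count {k} (λ _ → true)    ≤⟨ m≤n+m _ _ ⟩
    _                         ≡⟨ degreeᵛ-split (x i) ⟨
    degreeᵛ (x i)             ∎
    where open ≤-Reasoning

  k∸1≤degree-y : ∀ i → k ∸ 1 ≤ degreeᵛ (y i)
  k∸1≤degree-y i = begin
    k ∸ 1                                ≡⟨ count-≢ (missed i) ⟨
    count (λ j → not (missed i == j))    ≤⟨ m≤n+m _ _ ⟩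
    _                                    ≡⟨ degreeᵛ-split (y i) ⟨
    degreeᵛ (y i)                        ∎
    where open ≤-Reasoning

  m≤degree-a : ∀ j → m ≤ degreeᵛ (a j)
  m≤degree-a j = begin
    m                                                          ≡⟨ count-true m ⟨
    count {m} (λ _ → true)                                     ≤⟨ sum-mono-≤ (λ i → m≤m+n 1 (𝟙 (not (missed i == j)))) ⟩
    ∑[ i < m ] (1 + 𝟙 (not (missed i == j)))                   ≤⟨ m≤m+n _ _ ⟩
    _                                                          ≡⟨ degreeᵛ-split (a j) ⟨
    degreeᵛ (a j)                                              ∎
    where open ≤-Reasoning

  minDegree : ∀ {d} → d ≤ k ∸ 1 → d ≤ m → minDegreeAtLeast G d
  minDegree {d} d≤k∸1 d≤m v = subst (d ≤_) (sym (degree≡count G v)) (bound (decode m v))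
    where
    bound : ∀ u → d ≤ degreeᵛ u
    bound (x i) = ≤-trans d≤k∸1 (≤-trans (m∸n≤m k 1) (k≤degree-x i))
    bound (y i) = ≤-trans d≤k∸1 (k∸1≤degree-y i)
    bound (a j) = ≤-trans d≤m (m≤degree-a j)

  module _ (D : Orientation G) (S : Subset n) (S-locating : LocDom G D S) where

    inS : Vertex m k → Bool
    inS u = lookup S (encode m u)

    covered : Fin m → Bool
    covered i = inS (x i) ∨ inS (y i)

    signature : Fin m → Fin k → Bool
    signature i j = arc D (encode m (a j)) (encode m (x i))

    count-covered≤∣S∣ : count covered ≤ ∣ S ∣
    count-covered≤∣S∣ = begin
      count covered                                         ≤⟨ sum-mono-≤ (λ i → 𝟙-∨ (inS (x i)) (inS (y i))) ⟩
      ∑[ i < m ] (𝟙 (inS (x i)) + 𝟙 (inS (y i)))            ≤⟨ m≤m+n _ _ ⟩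
      _                                                     ≡⟨ sum-decode m (𝟙 ∘ inS) ⟨
      ∑[ v < n ] 𝟙 (inS (decode m v))                       ≡⟨ sum-cong-≗ (λ v → cong (𝟙 ∘ lookup S) (encode-decode m v)) ⟩
      count (lookup S)                                      ≡⟨ ∣p∣≡count S ⟨
      ∣ S ∣                                                 ∎
      where
      open ≤-Reasoning
      𝟙-∨ : ∀ b c → 𝟙 (b ∨ c) ≤ 𝟙 b + 𝟙 c
      𝟙-∨ false _ = ≤-refl
      𝟙-∨ true  _ = s≤s z≤n

    no-arc-from-x : ∀ l i → arc D (encode m (x l)) (encode m (x i)) ≡ false
    no-arc-from-x l i = ¬adj⇒¬arc D (adj-encode (x l) (x i))

    no-arc-from-y : ∀ {l i} → covered i ≡ false → inS (y l) ≡ true → arc D (encode m (y l)) (encode m (x i)) ≡ false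
    no-arc-from-y {l} {i} uncovered yₗ∈S with l ≟ i
    ... | yes refl = ⊥-elim (not-¬ yₗ∈S (proj₂ (∨-≡-false uncovered)))
    ... | no l≢i   = ¬adj⇒¬arc D (trans (adj-encode (y l) (x i)) (==-≢ (l≢i ∘ sym)))

    in-arcs-agree : ∀ {i l} → covered i ≡ false → covered l ≡ false → signature i ≗ signature l →
                    ∀ u → inS u ≡ true → arc D (encode m u) (encode m (x i)) ≡ arc D (encode m u) (encode m (x l))
    in-arcs-agree _ _ same (a j) _ = same j
    in-arcs-agree {i} {l} _ _ _ (x t) _ = trans (no-arc-from-x t i) (sym (no-arc-from-x t l))
    in-arcs-agree uncoveredᵢ uncoveredₗ _ (y t) yₜ∈S =
      trans (no-arc-from-y uncoveredᵢ yₜ∈S) (sym (no-arc-from-y uncoveredₗ yₜ∈S))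

    signature-injective : ∀ i l → not (covered i) ≡ true → not (covered l) ≡ true → signature i ≗ signature l → i ≡ l
    signature-injective i l uncoveredᵢ uncoveredₗ same with i ≟ l
    ... | yes i≡l = i≡l
    ... | no i≢l  = contradiction agree
      (proj₂ S-locating (encode m (x i)) (encode m (x l)) (x∉S cᵢ) (x∉S cₗ) (i≢l ∘ x-injective ∘ encode-injective m))
      where
      cᵢ : covered i ≡ false
      cᵢ = not-injective {y = false} uncoveredᵢ
      cₗ : covered l ≡ false
      cₗ = not-injective {y = false} uncoveredₗ
      x∉S : ∀ {t} → covered t ≡ false → encode m (x t) ∉ S
      x∉S uncovered x∈S = not-¬ ([]=⇒lookup x∈S) (proj₁ (∨-≡-false uncovered))
      agree : ∀ w → w ∈ S → arc D w (encode m (x i)) ≡ arc D w (encode m (x l))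
      agree w w∈S = subst (λ w → arc D w (encode m (x i)) ≡ arc D w (encode m (x l))) (encode-decode m w)
        (in-arcs-agree cᵢ cₗ same (decode m w) (trans (cong (lookup S) (encode-decode m w)) ([]=⇒lookup w∈S)))

    locating-bound : m ≤ ∣ S ∣ + 2 ^ k
    locating-bound = begin
      m                                        ≡⟨ count-complement covered ⟨
      count covered + count (not ∘ covered)    ≤⟨ +-mono-≤ count-covered≤∣S∣ (count-≤-2^ k _ signature signature-injective) ⟩
      ∣ S ∣ + 2 ^ k                            ∎
      where open ≤-Reasoning

module Instance (d r : ℕ) where

  k m : ℕ
  k = suc d
  m = k + suc r

  missed : Fin m → Fin k
  missed = [ id , (λ _ → zero) ]′ ∘ splitAt k

  owner : Fin k → Fin m
  owner j = j ↑ˡ suc r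

  partner : Fin m → Fin m
  partner zero    = k ↑ʳ zero
  partner (suc _) = zero

  partner-≢ : ∀ i → partner i ≢ i
  partner-≢ zero    ()
  partner-≢ (suc _) ()

  open Construction missed owner (λ j → cong [ id , _ ]′ (splitAt-↑ˡ k j (suc r))) partner partner-≢ public

  m≤n : m ≤ n
  m≤n = begin
    m           ≤⟨ m≤m+n m (m + 0) ⟩
    2 ℕ.* m     ≡⟨ double≡2* m ⟨
    double m    ≤⟨ m≤m+n (double m) k ⟩
    n           ∎
    where open ≤-Reasoning

  r≤n : r ≤ n
  r≤n = ≤-trans (≤-trans (n≤1+n r) (m≤n+m (suc r) k)) m≤n

  d≤m : d ≤ m
  d≤m = ≤-trans (n≤1+n d) (m≤m+n k (suc r))

  order-bound : ∀ {s} → m ≤ s + 2 ^ k → n ≤ 2 ℕ.* s + (2 ^ suc k + k)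
  order-bound {s} m≤s+2^k = begin
    double m + k                  ≡⟨ cong (_+ k) (double≡2* m) ⟩
    2 ℕ.* m + k                   ≤⟨ +-monoˡ-≤ k (*-monoʳ-≤ 2 m≤s+2^k) ⟩
    2 ℕ.* (s + 2 ^ k) + k         ≡⟨ cong (_+ k) (*-distribˡ-+ 2 s (2 ^ k)) ⟩
    2 ℕ.* s + 2 ^ suc k + k       ≡⟨ +-assoc (2 ℕ.* s) (2 ^ suc k) k ⟩
    2 ℕ.* s + (2 ^ suc k + k)     ∎
    where open ≤-Reasoning

-- Rational arithmetic

-- The cross-multiplied numerators of (1/2 - P/Q) · (N/1) ≤ S/1, in the shape ℚᵘ computes them.
½-numerator-bound : ∀ (Q P N S : ℤ) → Q ℤ.* N ℤ.≤ Q ℤ.* (+ 2 ℤ.* S) ℤ.+ + 2 ℤ.* P ℤ.* N →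
                    (+ 1 ℤ.* Q ℤ.+ (ℤ.- P) ℤ.* + 2) ℤ.* N ℤ.* + 1 ℤ.≤ S ℤ.* (+ 2 ℤ.* Q ℤ.* + 1)
½-numerator-bound Q P N S h = begin
  (+ 1 ℤ.* Q ℤ.+ (ℤ.- P) ℤ.* + 2) ℤ.* N ℤ.* + 1                    ≡⟨ lhs≡ Q P N ⟩
  Q ℤ.* N ℤ.- + 2 ℤ.* P ℤ.* N                                       ≤⟨ ℤP.+-monoˡ-≤ (ℤ.- (+ 2 ℤ.* P ℤ.* N)) h ⟩
  Q ℤ.* (+ 2 ℤ.* S) ℤ.+ + 2 ℤ.* P ℤ.* N ℤ.- + 2 ℤ.* P ℤ.* N         ≡⟨ rhs≡ Q P N S ⟩
  S ℤ.* (+ 2 ℤ.* Q ℤ.* + 1)                                         ∎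
  where
  open ℤP.≤-Reasoning
  lhs≡ : ∀ Q P N → (+ 1 ℤ.* Q ℤ.+ (ℤ.- P) ℤ.* + 2) ℤ.* N ℤ.* + 1 ≡ Q ℤ.* N ℤ.- + 2 ℤ.* P ℤ.* N
  lhs≡ = solve-∀
  rhs≡ : ∀ Q P N S → Q ℤ.* (+ 2 ℤ.* S) ℤ.+ + 2 ℤ.* P ℤ.* N ℤ.- + 2 ℤ.* P ℤ.* N ≡ S ℤ.* (+ 2 ℤ.* Q ℤ.* + 1)
  rhs≡ = solve-∀

½-ε-bound-mkℚ : ∀ p q-1 .(coprime : Coprime (suc p) (suc q-1)) n s →
             suc q-1 ℕ.* n ≤ suc q-1 ℕ.* (2 ℕ.* s) + 2 ℕ.* suc p ℕ.* n →
             (½ - mkℚ +[1+ p ] q-1 coprime) * (+ n / 1) ℚ.≤ + s / 1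
½-ε-bound-mkℚ p q-1 coprime n s h = ℚP.toℚᵘ-cancel-≤ (begin
  toℚᵘ ((½ - ε) * (+ n / 1))                      ≃⟨ ℚP.toℚᵘ-homo-* (½ - ε) (+ n / 1) ⟩
  toℚᵘ (½ - ε) ℚᵘ.* toℚᵘ (+ n / 1)                ≃⟨ ℚᵘP.*-cong toℚᵘ-½-ε (ℚP.toℚᵘ-fromℚᵘ (ℚᵘ.mkℚᵘ (+ n) 0)) ⟩
  (toℚᵘ ½ ℚᵘ.- toℚᵘ ε) ℚᵘ.* ℚᵘ.mkℚᵘ (+ n) 0       ≤⟨ ℚᵘ.*≤* (½-numerator-bound (+ suc q-1) +[1+ p ] (+ n) (+ s) hℤ) ⟩
  ℚᵘ.mkℚᵘ (+ s) 0                                 ≃⟨ ℚP.toℚᵘ-fromℚᵘ (ℚᵘ.mkℚᵘ (+ s) 0) ⟨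
  toℚᵘ (+ s / 1)                                  ∎)
  where
  open ℚᵘP.≤-Reasoning
  ε : ℚ
  ε = mkℚ +[1+ p ] q-1 coprime
  toℚᵘ-½-ε : toℚᵘ (½ - ε) ℚᵘ.≃ toℚᵘ ½ ℚᵘ.- toℚᵘ ε
  toℚᵘ-½-ε = ℚᵘP.≃-trans (ℚP.toℚᵘ-homo-+ ½ (ℚ.- ε)) (ℚᵘP.+-congʳ (toℚᵘ ½) (ℚP.toℚᵘ-homo‿- ε))
  hℤ : + suc q-1 ℤ.* + n ℤ.≤ + suc q-1 ℤ.* (+ 2 ℤ.* + s) ℤ.+ + 2 ℤ.* +[1+ p ] ℤ.* + n
  hℤ = subst₂ ℤ._≤_ (ℤP.pos-* (suc q-1) n)
         (trans (ℤP.pos-+ (suc q-1 ℕ.* (2 ℕ.* s)) (2 ℕ.* suc p ℕ.* n)) (cong₂ ℤ._+_ (trans (ℤP.pos-* (suc q-1) (2 ℕ.* s)) (cong (ℤ._*_ (+ suc q-1)) (ℤP.pos-* 2 s)))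
                                             (trans (ℤP.pos-* (2 ℕ.* suc p) n) (cong (ℤ._* + n) (ℤP.pos-* 2 (suc p))))))
         (ℤ.+≤+ h)

½-ε-bound : ∀ ε → 0ℚ < ε → Σ ℕ λ q → ∀ {n s c} → n ≤ 2 ℕ.* s + c → q ℕ.* c ≤ n → (½ - ε) * (+ n / 1) ℚ.≤ + s / 1
½-ε-bound (mkℚ +[1+ p ] q-1 coprime) _ = suc q-1 , λ {n} {s} {c} n≤2s+c qc≤n →
  ½-ε-bound-mkℚ p q-1 coprime n s (begin
    suc q-1 ℕ.* n                                     ≤⟨ *-monoʳ-≤ (suc q-1) n≤2s+c ⟩
    suc q-1 ℕ.* (2 ℕ.* s + c)                         ≡⟨ *-distribˡ-+ (suc q-1) (2 ℕ.* s) c ⟩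
    suc q-1 ℕ.* (2 ℕ.* s) + suc q-1 ℕ.* c             ≤⟨ +-monoʳ-≤ (suc q-1 ℕ.* (2 ℕ.* s)) (≤-trans qc≤n (m≤n*m n (2 ℕ.* suc p))) ⟩
    suc q-1 ℕ.* (2 ℕ.* s) + 2 ℕ.* suc p ℕ.* n         ∎)
  where open ≤-Reasoning
½-ε-bound (mkℚ (+ zero) _ _) (*<* (ℤ.+<+ ()))
½-ε-bound (mkℚ -[1+ _ ] _ _) (*<* ())

lemma23 : (d n₀ : ℕ) (ε : ℚ) → 0ℚ < ε →
            Σ ℕ λ n → Σ (Graph n) λ G →
              n₀ ≤ n × TwinFree G × minDegreeAtLeast G d
              × orientedLDAtLeast G ((½ - ε) * (+ n / 1))
lemma23 d n₀ ε 0<ε with ½-ε-bound ε 0<ε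
... | q , bound = n , G , ≤-trans (m≤n+m n₀ (q ℕ.* c)) r≤n , twinFree , minDegree ≤-refl d≤m ,
  λ D S S-locating → bound {s = ∣ S ∣} {c} (order-bound {∣ S ∣} (locating-bound D S S-locating)) (≤-trans (m≤m+n (q ℕ.* c) n₀) r≤n)
  where
  c : ℕ
  c = 2 ^ suc (suc d) + suc d
  open Instance d (q ℕ.* c + n₀)
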